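{- Let $A, B, C, D \in \mathbb{F}_2[x_1,\ldots,x_n]$ be multilinear polynomials and let $z$ be one of the variables $x_1,\ldots,x_n$. For $Q \in \{A,B,C,D\}$ write $Q_1 = \frac{\partial Q}{\partial z}$ and $Q_2 = Q_{z=0}$, so that $Q = Q_1 z + Q_2$ with $Q_1, Q_2$ not containing $z$. Assume $A_1 \neq 0$ and $A_2 \neq 0$. Then $AD = BC$ holds if and only if all of the following hold: (i) $A_1 D_1 = B_1 C_1$; (ii) $A_2 D_2 = B_2 C_2$; (iii) $A_1 B_2 = A_2 B_1$ or $A_1 C_2 = A_2 C_1$.
   Context: $\mathbb{F}_2$ is the field with two elements. A polynomial is multilinear if every variable occurs in each monomial with degree at most $1$. For a multilinear polynomial $F$, a variable $x$ and $a \in \{0,1\}$, $F_{x=a}$ denotes the polynomial obtained by substituting $a$ for $x$, and the formal derivative is defined as $\frac{\partial F}{\partial x} = F_{x=0} + F_{x=1}$. -}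

module Defs where

open import Data.Bool using (Bool; true; false; _xor_; _∧_; if_then_else_)
open import Data.Nat using (ℕ; zero; suc; _∸_; _≤_; _≡ᵇ_)
open import Data.Fin using (Fin)
open import Data.List using (List; []; _∷_; map; concatMap; upTo; foldr)
open import Data.Product using (_×_; _,_)
open import Data.Vec using (Vec; []; _∷_; lookup; _[_]≔_)
open import Data.Vec.Relation.Unary.All using (All)
open import Relation.Binary.PropositionalEquality using (_≡_)
open import Relation.Nullary using (¬_)

Mono : ℕ → Set
Mono n = Vec ℕ n

-- Polynomials in F₂[x_1..x_n], given by their coefficient function
-- (Bool = F₂, true = 1).  All polynomials used below have finite support.
Poly : ℕ → Set
Poly n = Mono n → Bool

infix 4 _≈_
_≈_ : ∀ {n} → Poly n → Poly n → Set
F ≈ G = ∀ m → F m ≡ G m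

0P : ∀ {n} → Poly n
0P _ = false

infixl 6 _⊕_
_⊕_ : ∀ {n} → Poly n → Poly n → Poly n
(F ⊕ G) m = F m xor G m

splits : ∀ {n} → Mono n → List (Mono n × Mono n)
splits [] = ([] , []) ∷ []
splits (k ∷ m) =
  concatMap (λ i → map (λ { (a , b) → (i ∷ a , (k ∸ i) ∷ b) }) (splits m))
            (upTo (suc k))

infixl 7 _⊛_
_⊛_ : ∀ {n} → Poly n → Poly n → Poly n
(F ⊛ G) m = foldr (λ { (a , b) acc → (F a ∧ G b) xor acc }) false (splits m)

Multilinear : ∀ {n} → Poly n → Set
Multilinear {n} F = ∀ (m : Mono n) → F m ≡ true → All (_≤ 1) m

subst0 : ∀ {n} → Poly n → Fin n → Poly n
subst0 F z m = if lookup m z ≡ᵇ 0 then F m else false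

-- Substitution z := 1 (for polynomials of degree ≤ 1 in z, in particular
-- multilinear ones): coefficient of m (with z-exponent 0) is F(m) + F(m·z).
subst1 : ∀ {n} → Poly n → Fin n → Poly n
subst1 F z m = if lookup m z ≡ᵇ 0 then F m xor F (m [ z ]≔ 1) else false

deriv : ∀ {n} → Poly n → Fin n → Poly n
deriv F z = subst0 F z ⊕ subst1 F z

module Submission where

-- A D = z² A₁D₁ + z (A₁D₂ + A₂D₁) + A₂D₂ with
--    z-free coefficients, so A D = B C iff (i), (ii) and the middle equation
--    A₁D₂ + A₂D₁ = B₁C₂ + B₂C₁ hold.
-- 2. An identity in characteristic 2: with U = A₁B₂ + A₂B₁, V = A₁C₂ + A₂C₁
--    and M = A₁D₂ + A₂D₁ + B₁C₂ + B₂C₁,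
--      A₁A₂ M = U V + A₁² (A₂D₂ + B₂C₂) + A₂² (A₁D₁ + B₁C₁),
--    so under (i) and (ii) we get A₁A₂ M = U V.
-- 3. Polynomials with bounded exponents form an integral domain with a
--    decidable zero test; cancelling A₁A₂ ≠ 0 turns M = 0 into U = 0 or V = 0,
--    which is (iii).

open import Defs
open import Data.Nat using (ℕ)
open import Data.Fin using (Fin)
open import Data.Product using (_×_)
open import Data.Sum using (_⊎_)
open import Relation.Nullary using (¬_)
open import Function.Bundles using (_⇔_)

open import Algebra.Bundles using (CommutativeRing; RawRing)
open import Algebra.Solver.Ring.AlmostCommutativeRing using (fromCommutativeRing; _-Raw-AlmostCommutative⟶_)
open import Data.Bool using (Bool; true; false; _xor_; _∧_; if_then_else_)
import Data.Bool as Bool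
open import Data.Bool.Properties
  using (xor-assoc; xor-comm; xor-identityʳ; xor-same; ∧-comm; ∧-assoc; ∧-zeroʳ; ∧-distribˡ-xor; ∧-distribʳ-xor)
open import Data.Fin using (zero; suc)
open import Data.List using (List; []; _∷_; foldr; _++_; map; concatMap; applyUpTo; upTo)
open import Data.Maybe using (Maybe; just; nothing)
open import Data.Nat using (zero; suc; _∸_; _+_; _≤_; _≰_; _<_; z≤n; s≤s; _≤?_; _<?_; _≡ᵇ_)
open import Data.Nat.Properties
  using (m∸[m∸n]≡n; ≤-pred; m+[n∸m]≡n; +-mono-≤; allUpTo?; m≤n⇒m<n∨m≡n; m≤m+n; m+n∸m≡n; ∸-monoʳ-<; ≤∧≢⇒<; ≮⇒≥)
open import Data.Product using (_,_; Σ)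
open import Data.Sum using (inj₁; inj₂)
open import Data.Sum.Function.Propositional using (_⊎-⇔_)
open import Data.Vec using ([]; _∷_; lookup; _[_]≔_)
open import Data.Vec.Properties using (lookup∘update; []≔-idempotent; []≔-lookup)
open import Data.Vec.Relation.Unary.All using (All; []; _∷_)
open import Data.Vec.Relation.Unary.All.Properties using (lookup⁺)
open import Function.Bundles using (mk⇔; Equivalence)
open import Function.Properties.Equivalence using (⇔-setoid)
open import Level using (0ℓ)
open import Relation.Nullary using (Dec; yes; no; contradiction)
open import Relation.Nullary.Decidable using (map′)
open import Relation.Binary.PropositionalEquality
  using (_≡_; _≢_; refl; sym; trans; cong; cong₂; subst; module ≡-Reasoning)

private variable
  I J : Set

xorSum : (I → Bool) → List I → Bool
xorSum h = foldr (λ x acc → h x xor acc) false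

xor-interchange : ∀ a b c d → (a xor b) xor (c xor d) ≡ (a xor c) xor (b xor d)
xor-interchange a b c d = begin
  (a xor b) xor (c xor d)   ≡⟨ xor-assoc a b (c xor d) ⟩
  a xor (b xor (c xor d))   ≡⟨ cong (a xor_) (sym (xor-assoc b c d)) ⟩
  a xor ((b xor c) xor d)   ≡⟨ cong (λ t → a xor (t xor d)) (xor-comm b c) ⟩
  a xor ((c xor b) xor d)   ≡⟨ cong (a xor_) (xor-assoc c b d) ⟩
  a xor (c xor (b xor d))   ≡⟨ sym (xor-assoc a c (b xor d)) ⟩
  (a xor c) xor (b xor d)   ∎
  where open ≡-Reasoning

xorSum-cong : {h h′ : I → Bool} → (∀ x → h x ≡ h′ x) → ∀ xs → xorSum h xs ≡ xorSum h′ xs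
xorSum-cong e []       = refl
xorSum-cong e (x ∷ xs) = cong₂ _xor_ (e x) (xorSum-cong e xs)

xorSum-zero : (h : I → Bool) → (∀ x → h x ≡ false) → ∀ xs → xorSum h xs ≡ false
xorSum-zero h e []       = refl
xorSum-zero h e (x ∷ xs) = cong₂ _xor_ (e x) (xorSum-zero h e xs)

xorSum-++ : (h : I → Bool) (xs ys : List I) → xorSum h (xs ++ ys) ≡ xorSum h xs xor xorSum h ys
xorSum-++ h []       ys = refl
xorSum-++ h (x ∷ xs) ys =
  trans (cong (h x xor_) (xorSum-++ h xs ys)) (sym (xor-assoc (h x) _ _))

xorSum-xor : (h h′ : I → Bool) (xs : List I) →
  xorSum (λ x → h x xor h′ x) xs ≡ xorSum h xs xor xorSum h′ xs
xorSum-xor h h′ []       = refl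
xorSum-xor h h′ (x ∷ xs) =
  trans (cong ((h x xor h′ x) xor_) (xorSum-xor h h′ xs)) (xor-interchange (h x) (h′ x) _ _)

xorSum-map : (h : J → Bool) (f : I → J) (xs : List I) →
  xorSum h (map f xs) ≡ xorSum (λ x → h (f x)) xs
xorSum-map h f []       = refl
xorSum-map h f (x ∷ xs) = cong (h (f x) xor_) (xorSum-map h f xs)

xorSum-concatMap : (h : J → Bool) (g : I → List J) (xs : List I) →
  xorSum h (concatMap g xs) ≡ xorSum (λ x → xorSum h (g x)) xs
xorSum-concatMap h g []       = refl
xorSum-concatMap h g (x ∷ xs) =
  trans (xorSum-++ h (g x) (concatMap g xs)) (cong (xorSum h (g x) xor_) (xorSum-concatMap h g xs))

sumBelow : (ℕ → Bool) → ℕ → Bool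
sumBelow f zero    = false
sumBelow f (suc N) = f 0 xor sumBelow (λ i → f (suc i)) N

xorSum-applyUpTo : (h : I → Bool) (f : ℕ → I) (N : ℕ) →
  xorSum h (applyUpTo f N) ≡ sumBelow (λ i → h (f i)) N
xorSum-applyUpTo h f zero    = refl
xorSum-applyUpTo h f (suc N) = cong (h (f 0) xor_) (xorSum-applyUpTo h (λ i → f (suc i)) N)

sumBelow-cong : {f g : ℕ → Bool} (N : ℕ) → (∀ i → i < N → f i ≡ g i) → sumBelow f N ≡ sumBelow g N
sumBelow-cong zero    e = refl
sumBelow-cong (suc N) e = cong₂ _xor_ (e 0 (s≤s z≤n)) (sumBelow-cong N (λ i i<N → e (suc i) (s≤s i<N)))

sumBelow-zero : {f : ℕ → Bool} (N : ℕ) → (∀ i → i < N → f i ≡ false) → sumBelow f N ≡ false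
sumBelow-zero zero    e = refl
sumBelow-zero (suc N) e = cong₂ _xor_ (e 0 (s≤s z≤n)) (sumBelow-zero N (λ i i<N → e (suc i) (s≤s i<N)))

sumBelow-snoc : (f : ℕ → Bool) (N : ℕ) → sumBelow f (suc N) ≡ sumBelow f N xor f N
sumBelow-snoc f zero    = xor-comm (f 0) false
sumBelow-snoc f (suc N) =
  trans (cong (f 0 xor_) (sumBelow-snoc (λ i → f (suc i)) N)) (sym (xor-assoc (f 0) _ _))

-- Summing f 0, ..., f k in reverse order: needed for commutativity of ⊛.
sumBelow-reverse : (f : ℕ → Bool) (k : ℕ) → sumBelow f (suc k) ≡ sumBelow (λ i → f (k ∸ i)) (suc k)
sumBelow-reverse f zero    = refl
sumBelow-reverse f (suc k) = begin
  sumBelow f (suc (suc k))                        ≡⟨ sumBelow-snoc f (suc k) ⟩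
  sumBelow f (suc k) xor f (suc k)                ≡⟨ xor-comm (sumBelow f (suc k)) (f (suc k)) ⟩
  f (suc k) xor sumBelow f (suc k)                ≡⟨ cong (f (suc k) xor_) (sumBelow-reverse f k) ⟩
  f (suc k) xor sumBelow (λ i → f (k ∸ i)) (suc k) ∎
  where open ≡-Reasoning

sumBelow-single : {f : ℕ → Bool} (N i₀ : ℕ) → i₀ < N →
  (∀ i → i < N → i ≢ i₀ → f i ≡ false) → sumBelow f N ≡ f i₀
sumBelow-single {f} (suc N) zero    _ others =
  trans (cong (f 0 xor_) (sumBelow-zero N (λ i i<N → others (suc i) (s≤s i<N) λ ())))
        (xor-identityʳ (f 0))
sumBelow-single {f} (suc N) (suc j) (s≤s j<N) others =
  trans (cong (_xor sumBelow (λ i → f (suc i)) N) (others 0 (s≤s z≤n) λ ()))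
        (sumBelow-single N j j<N (λ i i<N i≢j → others (suc i) (s≤s i<N) (λ { refl → i≢j refl })))

sumBelow-true : (f : ℕ → Bool) (N : ℕ) → sumBelow f N ≡ true → Σ ℕ λ i → i < N × f i ≡ true
sumBelow-true f (suc N) sum≡1 with f 0 in f0≡1
... | true  = 0 , s≤s z≤n , f0≡1
... | false with sumBelow-true (λ i → f (suc i)) N sum≡1
...   | i , i<N , fi≡1 = suc i , s≤s i<N , fi≡1

-- A polynomial in n + 1 variables is a polynomial in x₁ whose coefficients
-- (layers) are polynomials in the remaining n variables.

private variable
  n : ℕ

layer : Poly (suc n) → ℕ → Poly n
layer F i m = F (i ∷ m)

⊛-layer : ∀ {n} (F G : Poly (suc n)) (k : ℕ) (m : Mono n) →
  (F ⊛ G) (k ∷ m) ≡ sumBelow (λ i → (layer F i ⊛ layer G (k ∸ i)) m) (suc k)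
⊛-layer {n} F G k m =
  trans (xorSum-concatMap coeffProduct (λ i → map (prepend i) (splits m)) (upTo (suc k)))
  (trans (xorSum-applyUpTo (λ i → xorSum coeffProduct (map (prepend i) (splits m))) (λ i → i) (suc k))
         (sumBelow-cong (suc k) (λ i _ → xorSum-map coeffProduct (prepend i) (splits m))))
  where
  coeffProduct : Mono (suc n) × Mono (suc n) → Bool
  coeffProduct (a , b) = F a ∧ G b
  prepend : ℕ → Mono n × Mono n → Mono (suc n) × Mono (suc n)
  prepend i (a , b) = (i ∷ a , (k ∸ i) ∷ b)

⊛-cong : {F F′ G G′ : Poly n} → F ≈ F′ → G ≈ G′ → F ⊛ G ≈ F′ ⊛ G′
⊛-cong F≈F′ G≈G′ m = xorSum-cong (λ (a , b) → cong₂ _∧_ (F≈F′ a) (G≈G′ b)) (splits m)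

⊛-distribˡ : (F G H : Poly n) → F ⊛ (G ⊕ H) ≈ F ⊛ G ⊕ F ⊛ H
⊛-distribˡ F G H m =
  trans (xorSum-cong (λ (a , b) → ∧-distribˡ-xor (F a) (G b) (H b)) (splits m))
        (xorSum-xor (λ (a , b) → F a ∧ G b) (λ (a , b) → F a ∧ H b) (splits m))

⊛-distribʳ : (F G H : Poly n) → (G ⊕ H) ⊛ F ≈ G ⊛ F ⊕ H ⊛ F
⊛-distribʳ F G H m =
  trans (xorSum-cong (λ (a , b) → ∧-distribʳ-xor (F b) (G a) (H a)) (splits m))
        (xorSum-xor (λ (a , b) → G a ∧ F b) (λ (a , b) → H a ∧ F b) (splits m))

⊛-zeroˡ : (G : Poly n) → 0P ⊛ G ≈ 0P
⊛-zeroˡ G m = xorSum-zero _ (λ _ → refl) (splits m)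

⊛-zeroʳ : (F : Poly n) → F ⊛ 0P ≈ 0P
⊛-zeroʳ F m = xorSum-zero _ (λ (a , _) → ∧-zeroʳ (F a)) (splits m)

⊛-annihilˡ : {F : Poly n} (G : Poly n) → F ≈ 0P → F ⊛ G ≈ 0P
⊛-annihilˡ G F≈0 m = trans (⊛-cong {G = G} F≈0 (λ _ → refl) m) (⊛-zeroˡ G m)

⊛-annihilʳ : (F : Poly n) {G : Poly n} → G ≈ 0P → F ⊛ G ≈ 0P
⊛-annihilʳ F G≈0 m = trans (⊛-cong {F = F} (λ _ → refl) G≈0 m) (⊛-zeroʳ F m)

sumBelowP : (ℕ → Poly n) → ℕ → Poly n
sumBelowP s N m = sumBelow (λ i → s i m) N

⊛-distrib-sumBelowP : (P : Poly n) (s : ℕ → Poly n) (N : ℕ) →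
  P ⊛ sumBelowP s N ≈ sumBelowP (λ i → P ⊛ s i) N
⊛-distrib-sumBelowP P s zero    m = ⊛-zeroʳ P m
⊛-distrib-sumBelowP P s (suc N) m =
  trans (⊛-distribˡ P (s 0) (sumBelowP (λ i → s (suc i)) N) m)
        (cong ((P ⊛ s 0) m xor_) (⊛-distrib-sumBelowP P (λ i → s (suc i)) N m))

embed : Poly n → Poly (suc n)
embed P (zero  ∷ m) = P m
embed P (suc _ ∷ m) = false

timesX₁ : Poly (suc n) → Poly (suc n)
timesX₁ Q (zero  ∷ m) = false
timesX₁ Q (suc k ∷ m) = Q (k ∷ m)

-- (F - F_{x₁=0}) / x₁: drop layer 0 and lower every x₁-exponent by one.
divX₁ : Poly (suc n) → Poly (suc n)
divX₁ F (k ∷ m) = F (suc k ∷ m)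

embed-⊛ : (P : Poly n) (G : Poly (suc n)) (k : ℕ) (m : Mono n) →
  (embed P ⊛ G) (k ∷ m) ≡ (P ⊛ layer G k) m
embed-⊛ P G k m =
  trans (⊛-layer (embed P) G k m)
  (trans (cong ((P ⊛ layer G k) m xor_)
               (sumBelow-zero k (λ i _ → ⊛-zeroˡ (layer G (k ∸ suc i)) m)))
         (xor-identityʳ _))

timesX₁-⊛ : (Q H : Poly (suc n)) → timesX₁ Q ⊛ H ≈ timesX₁ (Q ⊛ H)
timesX₁-⊛ Q H (zero ∷ m) =
  trans (⊛-layer (timesX₁ Q) H 0 m) (cong (_xor false) (⊛-zeroˡ (layer H 0) m))
timesX₁-⊛ Q H (suc k ∷ m) =
  trans (⊛-layer (timesX₁ Q) H (suc k) m)
  (trans (cong (_xor sumBelow (λ i → (layer Q i ⊛ layer H (k ∸ i)) m) (suc k)) (⊛-zeroˡ (layer H (suc k)) m))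
         (sym (⊛-layer Q H k m)))

⊛-splitX₁ : (F G : Poly (suc n)) → F ⊛ G ≈ embed (layer F 0) ⊛ G ⊕ timesX₁ (divX₁ F ⊛ G)
⊛-splitX₁ F G (zero ∷ m) =
  trans (⊛-layer F G 0 m) (cong (_xor false) (sym (embed-⊛ (layer F 0) G 0 m)))
⊛-splitX₁ F G (suc k ∷ m) =
  trans (⊛-layer F G (suc k) m)
        (cong₂ _xor_ (sym (embed-⊛ (layer F 0) G (suc k) m)) (sym (⊛-layer (divX₁ F) G k m)))

-- The ring laws for ⊛ are proved by induction on the number of variables,
-- comparing the layers in x₁ via ⊛-layer.

1P : Poly n
1P {zero}  []  = true
1P {suc n}     = embed 1P

⊛-nullary : (F G : Poly 0) → (F ⊛ G) [] ≡ F [] ∧ G []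
⊛-nullary F G = xor-identityʳ (F [] ∧ G [])

⊛-identityˡ : (G : Poly n) → 1P ⊛ G ≈ G
⊛-identityˡ {zero}  G []      = ⊛-nullary 1P G
⊛-identityˡ {suc n} G (k ∷ m) = trans (embed-⊛ 1P G k m) (⊛-identityˡ (layer G k) m)

-- Commutativity: the Cauchy formula read backwards.
⊛-comm : (F G : Poly n) → F ⊛ G ≈ G ⊛ F
⊛-comm {zero}  F G []      = cong (_xor false) (∧-comm (F []) (G []))
⊛-comm {suc n} F G (k ∷ m) = begin
  (F ⊛ G) (k ∷ m)                                                    ≡⟨ ⊛-layer F G k m ⟩
  sumBelow (λ i → (layer F i ⊛ layer G (k ∸ i)) m) (suc k)
    ≡⟨ sumBelow-cong (suc k) (λ i _ → ⊛-comm (layer F i) (layer G (k ∸ i)) m) ⟩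
  sumBelow (λ i → (layer G (k ∸ i) ⊛ layer F i) m) (suc k)
    ≡⟨ sumBelow-reverse (λ i → (layer G (k ∸ i) ⊛ layer F i) m) k ⟩
  sumBelow (λ i → (layer G (k ∸ (k ∸ i)) ⊛ layer F (k ∸ i)) m) (suc k)
    ≡⟨ sumBelow-cong (suc k) (λ i i<1+k →
         cong (λ j → (layer G j ⊛ layer F (k ∸ i)) m) (m∸[m∸n]≡n (≤-pred i<1+k))) ⟩
  sumBelow (λ i → (layer G i ⊛ layer F (k ∸ i)) m) (suc k)           ≡⟨ ⊛-layer G F k m ⟨
  (G ⊛ F) (k ∷ m)                                                    ∎
  where open ≡-Reasoning

-- Associativity: split off the x₁-free part of the first factor and induct on
-- the x₁-degree k of the coefficient being compared.
⊛-assoc : (F G H : Poly n) → (F ⊛ G) ⊛ H ≈ F ⊛ (G ⊛ H)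
⊛-assoc {zero} F G H [] = begin
  ((F ⊛ G) ⊛ H) []          ≡⟨ trans (⊛-nullary (F ⊛ G) H) (cong (_∧ H []) (⊛-nullary F G)) ⟩
  (F [] ∧ G []) ∧ H []      ≡⟨ ∧-assoc (F []) (G []) (H []) ⟩
  F [] ∧ (G [] ∧ H [])      ≡⟨ trans (⊛-nullary F (G ⊛ H)) (cong (F [] ∧_) (⊛-nullary G H)) ⟨
  (F ⊛ (G ⊛ H)) []          ∎
  where open ≡-Reasoning
⊛-assoc {suc n} F G H (k ∷ m) = assocAt k F G H m
  where
  -- Associativity when the first factor is x₁-free: it holds layer by layer.
  embed-assoc : (P : Poly n) (G H : Poly (suc n)) → (embed P ⊛ G) ⊛ H ≈ embed P ⊛ (G ⊛ H)
  embed-assoc P G H (j ∷ m) = begin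
    ((embed P ⊛ G) ⊛ H) (j ∷ m)
      ≡⟨ ⊛-layer (embed P ⊛ G) H j m ⟩
    sumBelow (λ i → (layer (embed P ⊛ G) i ⊛ layer H (j ∸ i)) m) (suc j)
      ≡⟨ sumBelow-cong (suc j) (λ i _ →
           trans (⊛-cong {G = layer H (j ∸ i)} (embed-⊛ P G i) (λ _ → refl) m)
                 (⊛-assoc P (layer G i) (layer H (j ∸ i)) m)) ⟩
    sumBelowP (λ i → P ⊛ (layer G i ⊛ layer H (j ∸ i))) (suc j) m
      ≡⟨ ⊛-distrib-sumBelowP P (λ i → layer G i ⊛ layer H (j ∸ i)) (suc j) m ⟨
    (P ⊛ sumBelowP (λ i → layer G i ⊛ layer H (j ∸ i)) (suc j)) m
      ≡⟨ ⊛-cong {F = P} (λ _ → refl) (λ m′ → sym (⊛-layer G H j m′)) m ⟩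
    (P ⊛ layer (G ⊛ H) j) m
      ≡⟨ embed-⊛ P (G ⊛ H) j m ⟨
    (embed P ⊛ (G ⊛ H)) (j ∷ m) ∎
    where open ≡-Reasoning

  -- The coefficient of degree k in x₁, given the statement for divX₁ F at degree k - 1.
  assocStep : ∀ k (F G H : Poly (suc n)) m →
    timesX₁ ((divX₁ F ⊛ G) ⊛ H) (k ∷ m) ≡ timesX₁ (divX₁ F ⊛ (G ⊛ H)) (k ∷ m) →
    ((F ⊛ G) ⊛ H) (k ∷ m) ≡ (F ⊛ (G ⊛ H)) (k ∷ m)
  assocStep k F G H m step = begin
    ((F ⊛ G) ⊛ H) (k ∷ m)
      ≡⟨ ⊛-cong {G = H} (⊛-splitX₁ F G) (λ _ → refl) (k ∷ m) ⟩
    ((F₀ ⊛ G ⊕ timesX₁ (divX₁ F ⊛ G)) ⊛ H) (k ∷ m)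
      ≡⟨ ⊛-distribʳ H (F₀ ⊛ G) (timesX₁ (divX₁ F ⊛ G)) (k ∷ m) ⟩
    ((F₀ ⊛ G) ⊛ H) (k ∷ m) xor (timesX₁ (divX₁ F ⊛ G) ⊛ H) (k ∷ m)
      ≡⟨ cong₂ _xor_ (embed-assoc (layer F 0) G H (k ∷ m))
                     (trans (timesX₁-⊛ (divX₁ F ⊛ G) H (k ∷ m)) step) ⟩
    (F₀ ⊛ (G ⊛ H)) (k ∷ m) xor timesX₁ (divX₁ F ⊛ (G ⊛ H)) (k ∷ m)
      ≡⟨ ⊛-splitX₁ F (G ⊛ H) (k ∷ m) ⟨
    (F ⊛ (G ⊛ H)) (k ∷ m) ∎
    where
    open ≡-Reasoning
    F₀ : Poly (suc n)
    F₀ = embed (layer F 0)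

  assocAt : ∀ k (F G H : Poly (suc n)) m → ((F ⊛ G) ⊛ H) (k ∷ m) ≡ (F ⊛ (G ⊛ H)) (k ∷ m)
  assocAt zero    F G H m = assocStep zero F G H m refl
  assocAt (suc k) F G H m = assocStep (suc k) F G H m (assocAt k (divX₁ F) G H m)

-- Poly n is a commutative ring of characteristic 2, so negation is the identity.
polyRing : ℕ → CommutativeRing 0ℓ 0ℓ
polyRing n = record
  { Carrier = Poly n ; _≈_ = _≈_ ; _+_ = _⊕_ ; _*_ = _⊛_ ; -_ = λ F → F ; 0# = 0P ; 1# = 1P
  ; isCommutativeRing = record
    { isRing = record
      { +-isAbelianGroup = record
        { isGroup = record
          { isMonoid = record
            { isSemigroup = record
              { isMagma = record
                { isEquivalence = record
                  { refl = λ _ → refl ; sym = λ e m → sym (e m) ; trans = λ e f m → trans (e m) (f m) }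
                ; ∙-cong = λ e f m → cong₂ _xor_ (e m) (f m) }
              ; assoc = λ F G H m → xor-assoc (F m) (G m) (H m) }
            ; identity = (λ F m → refl) , (λ F m → xor-identityʳ (F m)) }
          ; inverse = (λ F m → xor-same (F m)) , (λ F m → xor-same (F m))
          ; ⁻¹-cong = λ e → e }
        ; comm = λ F G m → xor-comm (F m) (G m) }
      ; *-cong = ⊛-cong
      ; *-assoc = ⊛-assoc
      ; *-identity = ⊛-identityˡ , (λ F m → trans (⊛-comm F 1P m) (⊛-identityˡ F m))
      ; distrib = ⊛-distribˡ , ⊛-distribʳ }
    ; *-comm = ⊛-comm } }

-- The field F₂, used as the coefficient ring of a ring solver for Poly n:
-- normalising coefficients in F₂ makes the solver aware that 1 + 1 = 0.
𝔽₂ : RawRing 0ℓ 0ℓ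
𝔽₂ = record
  { Carrier = Bool ; _≈_ = _≡_ ; _+_ = _xor_ ; _*_ = _∧_ ; -_ = λ b → b ; 0# = false ; 1# = true }

module F₂-RingSolver (n : ℕ) where

  constant : Bool → Poly n
  constant b = if b then 1P else 0P

  constant-homomorphism : 𝔽₂ -Raw-AlmostCommutative⟶ fromCommutativeRing (polyRing n)
  constant-homomorphism = record
    { ⟦_⟧    = constant
    ; +-homo = +-homo
    ; *-homo = *-homo
    ; -‿homo = λ _ _ → refl
    ; 0-homo = λ _ → refl
    ; 1-homo = λ _ → refl
    }
    where
    +-homo : ∀ a b → constant (a xor b) ≈ constant a ⊕ constant b
    +-homo false b     m = refl
    +-homo true  false m = sym (xor-identityʳ (1P m))
    +-homo true  true  m = sym (xor-same (1P m))
    *-homo : ∀ a b → constant (a ∧ b) ≈ constant a ⊛ constant b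
    *-homo false b     m = sym (⊛-zeroˡ (constant b) m)
    *-homo true  false m = sym (⊛-zeroʳ 1P m)
    *-homo true  true  m = sym (⊛-identityˡ 1P m)

  equalConstants? : ∀ a b → Maybe (constant a ≈ constant b)
  equalConstants? false false = just (λ _ → refl)
  equalConstants? true  true  = just (λ _ → refl)
  equalConstants? _     _     = nothing

  open import Algebra.Solver.Ring 𝔽₂ (fromCommutativeRing (polyRing n)) constant-homomorphism equalConstants?
    public

-- All monomials occurring in P have every exponent at most b.  Multilinear
-- polynomials are exactly those of bound 1; bounds make "P ≈ 0P" decidable.
Bounded : ℕ → Poly n → Set
Bounded b P = ∀ m → P m ≡ true → All (_≤ b) m

bounded-layer : {b : ℕ} (P : Poly (suc n)) (i : ℕ) → Bounded b P → Bounded b (layer P i)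
bounded-layer P i bound m Pim≡1 with bound (i ∷ m) Pim≡1
... | _ ∷ m≤b = m≤b

bounded-highLayer : {b : ℕ} (P : Poly (suc n)) (i : ℕ) → Bounded b P → i ≰ b → layer P i ≈ 0P
bounded-highLayer P i bound i≰b m with P (i ∷ m) in Pim
... | false = refl
... | true with bound (i ∷ m) Pim
...   | i≤b ∷ _ = contradiction i≤b i≰b

bounded-⊕ : {b : ℕ} (P Q : Poly n) → Bounded b P → Bounded b Q → Bounded b (P ⊕ Q)
bounded-⊕ P Q boundP boundQ m sum≡1 with P m in Pm
... | true  = boundP m Pm
... | false = boundQ m sum≡1

bounded-contributing : {b : ℕ} (P : Poly (suc n)) (i : ℕ) (G : Poly n) (m : Mono n) →
  Bounded b P → (layer P i ⊛ G) m ≡ true → i ≤ b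
bounded-contributing {b = b} P i G m bound product≡1 with i ≤? b
... | yes i≤b = i≤b
... | no  i≰b = contradiction (trans (sym product≡1) (⊛-annihilˡ G (bounded-highLayer P i bound i≰b) m)) λ ()

bounded-⊛ : {b₁ b₂ : ℕ} (P Q : Poly n) → Bounded b₁ P → Bounded b₂ Q → Bounded (b₁ + b₂) (P ⊛ Q)
bounded-⊛ {zero}              P Q boundP boundQ [] _ = []
bounded-⊛ {suc n} {b₁} {b₂} P Q boundP boundQ (k ∷ m) product≡1
  with sumBelow-true _ (suc k) (trans (sym (⊛-layer P Q k m)) product≡1)
... | i , i<1+k , term≡1 =
  subst (_≤ b₁ + b₂) (m+[n∸m]≡n (≤-pred i<1+k)) (+-mono-≤ i≤b₁ k∸i≤b₂)
  ∷ bounded-⊛ (layer P i) (layer Q (k ∸ i)) (bounded-layer P i boundP) (bounded-layer Q (k ∸ i) boundQ) m term≡1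
  where
  i≤b₁ : i ≤ b₁
  i≤b₁ = bounded-contributing P i (layer Q (k ∸ i)) m boundP term≡1
  k∸i≤b₂ : k ∸ i ≤ b₂
  k∸i≤b₂ = bounded-contributing Q (k ∸ i) (layer P i) m boundQ
             (trans (⊛-comm (layer Q (k ∸ i)) (layer P i) m) term≡1)

bounded-fromLayers : {b : ℕ} (P : Poly (suc n)) → Bounded b P → (∀ {i} → i < suc b → layer P i ≈ 0P) → P ≈ 0P
bounded-fromLayers {b = b} P bound low (i ∷ m) with i ≤? b
... | yes i≤b = low (s≤s i≤b) m
... | no  i≰b = bounded-highLayer P i bound i≰b m

zero? : (b : ℕ) (P : Poly n) → Bounded b P → Dec (P ≈ 0P)
zero? {zero}  b P _     = map′ (λ { P[]≡0 [] → P[]≡0 }) (λ P≈0 → P≈0 []) (P [] Bool.≟ false)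
zero? {suc n} b P bound =
  map′ (bounded-fromLayers P bound) (λ P≈0 _ m → P≈0 (_ ∷ m))
       (allUpTo? (λ i → zero? b (layer P i) (bounded-layer P i bound)) (suc b))

leastFailure : {P : ℕ → Set} → (∀ i → Dec (P i)) → (v : ℕ) → ¬ (∀ {i} → i < v → P i) →
  Σ ℕ λ i → ¬ P i × (∀ {j} → j < i → P j)
leastFailure         P? zero    notAll = contradiction (λ ()) notAll
leastFailure {P = P} P? (suc v) notAll with allUpTo? P? v
... | no  notBelow = leastFailure P? v notBelow
... | yes below    = v , (λ Pv → notAll (upToIncluding Pv)) , below
  where
  upToIncluding : P v → ∀ {i} → i < suc v → P i
  upToIncluding Pv (s≤s i≤v) with m≤n⇒m<n∨m≡n i≤v
  ... | inj₁ i<v  = below i<v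
  ... | inj₂ refl = Pv

lowestLayer : {b : ℕ} (P : Poly (suc n)) → Bounded b P → ¬ P ≈ 0P →
  Σ ℕ λ i → ¬ layer P i ≈ 0P × (∀ {j} → j < i → layer P j ≈ 0P)
lowestLayer {b = b} P bound P≉0 =
  leastFailure (λ i → zero? b (layer P i) (bounded-layer P i bound)) (suc b)
    (λ low → P≉0 (bounded-fromLayers P bound low))

⊛-lowestLayers : (U V : Poly (suc n)) (i₀ j₀ : ℕ) →
  (∀ {i} → i < i₀ → layer U i ≈ 0P) → (∀ {j} → j < j₀ → layer V j ≈ 0P) →
  layer (U ⊛ V) (i₀ + j₀) ≈ layer U i₀ ⊛ layer V j₀
⊛-lowestLayers U V i₀ j₀ lowU lowV m = begin
  (U ⊛ V) (i₀ + j₀ ∷ m)                      ≡⟨ ⊛-layer U V (i₀ + j₀) m ⟩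
  sumBelow term (suc (i₀ + j₀))              ≡⟨ sumBelow-single (suc (i₀ + j₀)) i₀ (s≤s (m≤m+n i₀ j₀)) others ⟩
  term i₀                                    ≡⟨ cong (λ j → (layer U i₀ ⊛ layer V j) m) (m+n∸m≡n i₀ j₀) ⟩
  (layer U i₀ ⊛ layer V j₀) m                ∎
  where
  open ≡-Reasoning
  term : ℕ → Bool
  term i = (layer U i ⊛ layer V (i₀ + j₀ ∸ i)) m
  others : ∀ i → i < suc (i₀ + j₀) → i ≢ i₀ → term i ≡ false
  others i (s≤s i≤i₀+j₀) i≢i₀ with i <? i₀
  ... | yes i<i₀ = ⊛-annihilˡ (layer V (i₀ + j₀ ∸ i)) (lowU i<i₀) m
  ... | no  i≮i₀ = ⊛-annihilʳ (layer U i) (lowV rest<j₀) m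
    where
    rest<j₀ : i₀ + j₀ ∸ i < j₀
    rest<j₀ = subst (i₀ + j₀ ∸ i <_) (m+n∸m≡n i₀ j₀)
                    (∸-monoʳ-< (≤∧≢⇒< (≮⇒≥ i≮i₀) (λ i₀≡i → i≢i₀ (sym i₀≡i))) i≤i₀+j₀)

-- Polynomials of bounded support form an integral domain: multiply the lowest
-- nonzero layers in x₁ and use induction on the number of variables.
no-zero-divisors : (b : ℕ) (U V : Poly n) → Bounded b U → Bounded b V →
  ¬ U ≈ 0P → ¬ V ≈ 0P → ¬ U ⊛ V ≈ 0P
no-zero-divisors {zero} b U V _ _ U≉0 V≉0 UV≈0 with U [] in U[] | V [] in V[]
... | false | _     = U≉0 λ { [] → U[] }
... | true  | false = V≉0 λ { [] → V[] }
... | true  | true  = contradiction (trans (sym (cong₂ (λ u v → u ∧ v xor false) U[] V[])) (UV≈0 [])) λ ()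
no-zero-divisors {suc n} b U V boundU boundV U≉0 V≉0 UV≈0
  with lowestLayer U boundU U≉0 | lowestLayer V boundV V≉0
... | i₀ , Uᵢ₀≉0 , lowU | j₀ , Vⱼ₀≉0 , lowV =
  no-zero-divisors b (layer U i₀) (layer V j₀) (bounded-layer U i₀ boundU) (bounded-layer V j₀ boundV)
    Uᵢ₀≉0 Vⱼ₀≉0
    (λ m → trans (sym (⊛-lowestLayers U V i₀ j₀ lowU lowV m)) (UV≈0 (i₀ + j₀ ∷ m)))

zero-product : (b : ℕ) (U V : Poly n) → Bounded b U → Bounded b V → U ⊛ V ≈ 0P → U ≈ 0P ⊎ V ≈ 0P
zero-product b U V boundU boundV UV≈0 with zero? b U boundU | zero? b V boundV
... | yes U≈0 | _       = inj₁ U≈0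
... | no  _   | yes V≈0 = inj₂ V≈0
... | no  U≉0 | no  V≉0 = contradiction UV≈0 (no-zero-divisors b U V boundU boundV U≉0 V≉0)

X : Fin n → Poly n
X {suc n} zero    = timesX₁ 1P
X {suc n} (suc z) = embed (X z)

coeffBelow : Poly n → Fin n → Mono n → ℕ → Bool
coeffBelow P z m zero    = false
coeffBelow P z m (suc k) = P (m [ z ]≔ k)

X-⊛ : (z : Fin n) (P : Poly n) (m : Mono n) (k : ℕ) → (X z ⊛ P) (m [ z ]≔ k) ≡ coeffBelow P z m k
X-⊛ zero    P (i ∷ m) zero    = timesX₁-⊛ 1P P (0 ∷ m)
X-⊛ zero    P (i ∷ m) (suc k) = trans (timesX₁-⊛ 1P P (suc k ∷ m)) (⊛-identityˡ P (k ∷ m))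
X-⊛ (suc z) P (i ∷ m) zero    = trans (embed-⊛ (X z) P i (m [ z ]≔ 0)) (X-⊛ z (layer P i) m zero)
X-⊛ (suc z) P (i ∷ m) (suc k) = trans (embed-⊛ (X z) P i (m [ z ]≔ suc k)) (X-⊛ z (layer P i) m (suc k))

-- Every monomial m is m[z]≔k for k its z-exponent, so statements about all
-- monomials can be proved at the points m[z]≔k.
byZExponent : (z : Fin n) (Q : Mono n → Set) → (∀ m k → Q (m [ z ]≔ k)) → ∀ m → Q m
byZExponent z Q atExponent m = subst Q ([]≔-lookup m z) (atExponent m (lookup m z))

≈-byZExponent : (z : Fin n) {P Q : Poly n} → (∀ m k → P (m [ z ]≔ k) ≡ Q (m [ z ]≔ k)) → P ≈ Q
≈-byZExponent z {P} {Q} = byZExponent z (λ m → P m ≡ Q m)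

module _ (A : Poly n) (z : Fin n) (m : Mono n) where

  private
    isZero : ℕ → Bool
    isZero k = k ≡ᵇ 0

  subst0-at-zero : subst0 A z (m [ z ]≔ 0) ≡ A (m [ z ]≔ 0)
  subst0-at-zero = cong (λ k → if isZero k then A (m [ z ]≔ 0) else false) (lookup∘update z m 0)

  subst0-at-suc : ∀ k → subst0 A z (m [ z ]≔ suc k) ≡ false
  subst0-at-suc k = cong (λ j → if isZero j then A (m [ z ]≔ suc k) else false) (lookup∘update z m (suc k))

  deriv-at-zero : deriv A z (m [ z ]≔ 0) ≡ A (m [ z ]≔ 1)
  deriv-at-zero = begin
    deriv A z m₀
      ≡⟨ cong (λ k → (if isZero k then A m₀ else false) xor (if isZero k then A m₀ xor A (m₀ [ z ]≔ 1) else false))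
              (lookup∘update z m 0) ⟩
    A m₀ xor (A m₀ xor A (m₀ [ z ]≔ 1))   ≡⟨ xor-assoc (A m₀) (A m₀) _ ⟨
    (A m₀ xor A m₀) xor A (m₀ [ z ]≔ 1)   ≡⟨ cong (_xor A (m₀ [ z ]≔ 1)) (xor-same (A m₀)) ⟩
    A (m₀ [ z ]≔ 1)                       ≡⟨ cong A ([]≔-idempotent m z) ⟩
    A (m [ z ]≔ 1)                        ∎
    where
    open ≡-Reasoning
    m₀ : Mono n
    m₀ = m [ z ]≔ 0

  deriv-at-suc : ∀ k → deriv A z (m [ z ]≔ suc k) ≡ false
  deriv-at-suc k =
    cong (λ j → (if isZero j then A mₖ else false) xor (if isZero j then A mₖ xor A (mₖ [ z ]≔ 1) else false))
         (lookup∘update z m (suc k))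
    where
    mₖ : Mono n
    mₖ = m [ z ]≔ suc k

All-update : {P : ℕ → Set} (m : Mono n) (z : Fin n) {j k : ℕ} → All P (m [ z ]≔ j) → P k → All P (m [ z ]≔ k)
All-update (_ ∷ m) zero    (_ ∷ ps) p = p ∷ ps
All-update (_ ∷ m) (suc z) (q ∷ ps) p = q ∷ All-update m z ps p

bounded-deriv : {b : ℕ} (z : Fin n) (A : Poly n) → Bounded b A → Bounded b (deriv A z)
bounded-deriv {b = b} z A bound = byZExponent z (λ m → deriv A z m ≡ true → All (_≤ b) m) atExponent
  where
  atExponent : ∀ m k → deriv A z (m [ z ]≔ k) ≡ true → All (_≤ b) (m [ z ]≔ k)
  atExponent m zero    A₁≡1 = All-update m z (bound _ (trans (sym (deriv-at-zero A z m)) A₁≡1)) z≤n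
  atExponent m (suc k) A₁≡1 = contradiction (trans (sym A₁≡1) (deriv-at-suc A z m k)) λ ()

bounded-subst0 : {b : ℕ} (z : Fin n) (A : Poly n) → Bounded b A → Bounded b (subst0 A z)
bounded-subst0 {b = b} z A bound = byZExponent z (λ m → subst0 A z m ≡ true → All (_≤ b) m) atExponent
  where
  atExponent : ∀ m k → subst0 A z (m [ z ]≔ k) ≡ true → All (_≤ b) (m [ z ]≔ k)
  atExponent m zero    A₂≡1 = bound _ (trans (sym (subst0-at-zero A z m)) A₂≡1)
  atExponent m (suc k) A₂≡1 = contradiction (trans (sym A₂≡1) (subst0-at-suc A z m k)) λ ()

multilinear-split : (z : Fin n) (A : Poly n) → Multilinear A → A ≈ X z ⊛ deriv A z ⊕ subst0 A z
multilinear-split z A multilinear = ≈-byZExponent z (λ m k → sym (atExponent m k))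
  where
  atExponent : ∀ m k → (X z ⊛ deriv A z ⊕ subst0 A z) (m [ z ]≔ k) ≡ A (m [ z ]≔ k)
  atExponent m zero = cong₂ _xor_ (X-⊛ z (deriv A z) m 0) (subst0-at-zero A z m)
  atExponent m (suc zero) = begin
    (X z ⊛ deriv A z) (m [ z ]≔ 1) xor subst0 A z (m [ z ]≔ 1)
      ≡⟨ cong₂ _xor_ (X-⊛ z (deriv A z) m 1) (subst0-at-suc A z m 0) ⟩
    deriv A z (m [ z ]≔ 0) xor false       ≡⟨ xor-identityʳ _ ⟩
    deriv A z (m [ z ]≔ 0)                  ≡⟨ deriv-at-zero A z m ⟩
    A (m [ z ]≔ 1)                          ∎
    where open ≡-Reasoning
  atExponent m (suc (suc k)) = begin
    (X z ⊛ deriv A z) (m [ z ]≔ suc (suc k)) xor subst0 A z (m [ z ]≔ suc (suc k))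
      ≡⟨ cong₂ _xor_ (X-⊛ z (deriv A z) m (suc (suc k))) (subst0-at-suc A z m (suc k)) ⟩
    deriv A z (m [ z ]≔ suc k) xor false    ≡⟨ cong (_xor false) (deriv-at-suc A z m k) ⟩
    false                                   ≡⟨ exponentTooHigh ⟨
    A (m [ z ]≔ suc (suc k))                ∎
    where
    open ≡-Reasoning
    exponentTooHigh : A (m [ z ]≔ suc (suc k)) ≡ false
    exponentTooHigh with A (m [ z ]≔ suc (suc k)) in A≡1
    ... | false = refl
    ... | true  with subst (_≤ 1) (lookup∘update z m (suc (suc k))) (lookup⁺ (multilinear _ A≡1) z)
    ...   | s≤s ()

ZFree : Fin n → Poly n → Set
ZFree z P = ∀ m k → P (m [ z ]≔ suc k) ≡ false

zfree-deriv : (z : Fin n) (A : Poly n) → ZFree z (deriv A z)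
zfree-deriv z A m = deriv-at-suc A z m

zfree-subst0 : (z : Fin n) (A : Poly n) → ZFree z (subst0 A z)
zfree-subst0 z A m = subst0-at-suc A z m

zfree-⊕ : (z : Fin n) {P Q : Poly n} → ZFree z P → ZFree z Q → ZFree z (P ⊕ Q)
zfree-⊕ z freeP freeQ m k = cong₂ _xor_ (freeP m k) (freeQ m k)

zfree-⊛ : (z : Fin n) (P Q : Poly n) → ZFree z P → ZFree z Q → ZFree z (P ⊛ Q)
zfree-⊛ zero P Q freeP freeQ (_ ∷ m) k = begin
  (P ⊛ Q) (suc k ∷ m)
    ≡⟨ ⊛-splitX₁ P Q (suc k ∷ m) ⟩
  (embed (layer P 0) ⊛ Q) (suc k ∷ m) xor (divX₁ P ⊛ Q) (k ∷ m)
    ≡⟨ cong (_xor (divX₁ P ⊛ Q) (k ∷ m)) (embed-⊛ (layer P 0) Q (suc k) m) ⟩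
  (layer P 0 ⊛ layer Q (suc k)) m xor (divX₁ P ⊛ Q) (k ∷ m)
    ≡⟨ cong₂ _xor_ (⊛-annihilʳ (layer P 0) (λ m′ → freeQ (0 ∷ m′) k) m)
                   (⊛-annihilˡ {F = divX₁ P} Q (λ { (j ∷ m′) → freeP (0 ∷ m′) j }) (k ∷ m)) ⟩
  false ∎
  where open ≡-Reasoning
zfree-⊛ (suc z) P Q freeP freeQ (i ∷ m) k =
  trans (⊛-layer P Q i (m [ z ]≔ suc k))
        (sumBelow-zero (suc i) λ j _ →
           zfree-⊛ z (layer P j) (layer Q (i ∸ j)) (λ m′ → freeP (j ∷ m′)) (λ m′ → freeQ (i ∸ j ∷ m′)) m k)

zfree-ext : (z : Fin n) {P Q : Poly n} → ZFree z P → ZFree z Q →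
  (∀ m → P (m [ z ]≔ 0) ≡ Q (m [ z ]≔ 0)) → P ≈ Q
zfree-ext z {P} {Q} freeP freeQ agree = ≈-byZExponent z atExponent
  where
  atExponent : ∀ m k → P (m [ z ]≔ k) ≡ Q (m [ z ]≔ k)
  atExponent m zero    = agree m
  atExponent m (suc k) = trans (freeP m k) (sym (freeQ m k))

module _ (z : Fin n) where

  quadratic : Poly n → Poly n → Poly n → Poly n
  quadratic p₂ p₁ p₀ = X z ⊛ (X z ⊛ p₂) ⊕ X z ⊛ p₁ ⊕ p₀

  quadratic-cong : {p₂ p₁ p₀ q₂ q₁ q₀ : Poly n} → p₂ ≈ q₂ → p₁ ≈ q₁ → p₀ ≈ q₀ →
    quadratic p₂ p₁ p₀ ≈ quadratic q₂ q₁ q₀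
  quadratic-cong e₂ e₁ e₀ m =
    cong₂ _xor_ (cong₂ _xor_ (⊛-cong {F = X z} (λ _ → refl) (⊛-cong {F = X z} (λ _ → refl) e₂) m)
                             (⊛-cong {F = X z} (λ _ → refl) e₁ m))
                (e₀ m)

  quadratic-at-0 : (p₂ p₁ p₀ : Poly n) (m : Mono n) → quadratic p₂ p₁ p₀ (m [ z ]≔ 0) ≡ p₀ (m [ z ]≔ 0)
  quadratic-at-0 p₂ p₁ p₀ m = cong₂ (λ u v → (u xor v) xor p₀ (m [ z ]≔ 0))
                                    (X-⊛ z (X z ⊛ p₂) m 0) (X-⊛ z p₁ m 0)

  module _ (p₂ p₁ p₀ : Poly n) (free₁ : ZFree z p₁) (free₀ : ZFree z p₀) (m : Mono n) where

    quadratic-at-1 : quadratic p₂ p₁ p₀ (m [ z ]≔ 1) ≡ p₁ (m [ z ]≔ 0)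
    quadratic-at-1 = begin
      ((X z ⊛ (X z ⊛ p₂)) (m [ z ]≔ 1) xor (X z ⊛ p₁) (m [ z ]≔ 1)) xor p₀ (m [ z ]≔ 1)
        ≡⟨ cong₂ (λ u v → (u xor v) xor p₀ (m [ z ]≔ 1))
                 (trans (X-⊛ z (X z ⊛ p₂) m 1) (X-⊛ z p₂ m 0)) (X-⊛ z p₁ m 1) ⟩
      p₁ (m [ z ]≔ 0) xor p₀ (m [ z ]≔ 1)    ≡⟨ cong (p₁ (m [ z ]≔ 0) xor_) (free₀ m 0) ⟩
      p₁ (m [ z ]≔ 0) xor false              ≡⟨ xor-identityʳ _ ⟩
      p₁ (m [ z ]≔ 0)                        ∎
      where open ≡-Reasoning

    quadratic-at-2 : quadratic p₂ p₁ p₀ (m [ z ]≔ 2) ≡ p₂ (m [ z ]≔ 0)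
    quadratic-at-2 = begin
      ((X z ⊛ (X z ⊛ p₂)) (m [ z ]≔ 2) xor (X z ⊛ p₁) (m [ z ]≔ 2)) xor p₀ (m [ z ]≔ 2)
        ≡⟨ cong₂ (λ u v → (u xor v) xor p₀ (m [ z ]≔ 2))
                 (trans (X-⊛ z (X z ⊛ p₂) m 2) (X-⊛ z p₂ m 1)) (trans (X-⊛ z p₁ m 2) (free₁ m 0)) ⟩
      (p₂ (m [ z ]≔ 0) xor false) xor p₀ (m [ z ]≔ 2) ≡⟨ cong₂ _xor_ (xor-identityʳ (p₂ (m [ z ]≔ 0))) (free₀ m 1) ⟩
      p₂ (m [ z ]≔ 0) xor false                      ≡⟨ xor-identityʳ _ ⟩
      p₂ (m [ z ]≔ 0)                                ∎
      where open ≡-Reasoning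

  quadratic-injective : {p₂ p₁ p₀ q₂ q₁ q₀ : Poly n} →
    ZFree z p₂ → ZFree z p₁ → ZFree z p₀ → ZFree z q₂ → ZFree z q₁ → ZFree z q₀ →
    quadratic p₂ p₁ p₀ ≈ quadratic q₂ q₁ q₀ → p₂ ≈ q₂ × p₁ ≈ q₁ × p₀ ≈ q₀
  quadratic-injective {p₂} {p₁} {p₀} {q₂} {q₁} {q₀} fp₂ fp₁ fp₀ fq₂ fq₁ fq₀ p≈q =
      zfree-ext z fp₂ fq₂ (λ m → compare m 2 (quadratic-at-2 p₂ p₁ p₀ fp₁ fp₀ m)
                                             (quadratic-at-2 q₂ q₁ q₀ fq₁ fq₀ m))
    , zfree-ext z fp₁ fq₁ (λ m → compare m 1 (quadratic-at-1 p₂ p₁ p₀ fp₁ fp₀ m)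
                                             (quadratic-at-1 q₂ q₁ q₀ fq₁ fq₀ m))
    , zfree-ext z fp₀ fq₀ (λ m → compare m 0 (quadratic-at-0 p₂ p₁ p₀ m) (quadratic-at-0 q₂ q₁ q₀ m))
    where
    compare : ∀ m k {u v : Bool} →
      quadratic p₂ p₁ p₀ (m [ z ]≔ k) ≡ u → quadratic q₂ q₁ q₀ (m [ z ]≔ k) ≡ v → u ≡ v
    compare m k p≡u q≡v = trans (sym p≡u) (trans (p≈q (m [ z ]≔ k)) q≡v)

product-expansion : (x f₁ f₂ g₁ g₂ : Poly n) →
  (x ⊛ f₁ ⊕ f₂) ⊛ (x ⊛ g₁ ⊕ g₂) ≈ x ⊛ (x ⊛ (f₁ ⊛ g₁)) ⊕ x ⊛ (f₁ ⊛ g₂ ⊕ f₂ ⊛ g₁) ⊕ f₂ ⊛ g₂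
product-expansion {n} = solve 5 (λ x f₁ f₂ g₁ g₂ →
  (x :* f₁ :+ f₂) :* (x :* g₁ :+ g₂) := x :* (x :* (f₁ :* g₁)) :+ x :* (f₁ :* g₂ :+ f₂ :* g₁) :+ f₂ :* g₂)
  (λ _ → refl)
  where open F₂-RingSolver n

-- The identity behind condition (iii); it holds because 1 + 1 = 0:
-- a₁a₂ (a₁d₂ + a₂d₁ + b₁c₂ + b₂c₁)
--   = (a₁b₂ + a₂b₁)(a₁c₂ + a₂c₁) + a₁² (a₂d₂ + b₂c₂) + a₂² (a₁d₁ + b₁c₁).
middle-identity : (a₁ a₂ b₁ b₂ c₁ c₂ d₁ d₂ : Poly n) →
  (a₁ ⊛ a₂) ⊛ ((a₁ ⊛ d₂ ⊕ a₂ ⊛ d₁) ⊕ (b₁ ⊛ c₂ ⊕ b₂ ⊛ c₁)) ≈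
    (a₁ ⊛ b₂ ⊕ a₂ ⊛ b₁) ⊛ (a₁ ⊛ c₂ ⊕ a₂ ⊛ c₁)
    ⊕ (a₁ ⊛ a₁) ⊛ (a₂ ⊛ d₂ ⊕ b₂ ⊛ c₂) ⊕ (a₂ ⊛ a₂) ⊛ (a₁ ⊛ d₁ ⊕ b₁ ⊛ c₁)
middle-identity {n} = solve 8 (λ a₁ a₂ b₁ b₂ c₁ c₂ d₁ d₂ →
  (a₁ :* a₂) :* ((a₁ :* d₂ :+ a₂ :* d₁) :+ (b₁ :* c₂ :+ b₂ :* c₁)) :=
    (a₁ :* b₂ :+ a₂ :* b₁) :* (a₁ :* c₂ :+ a₂ :* c₁)
    :+ (a₁ :* a₁) :* (a₂ :* d₂ :+ b₂ :* c₂) :+ (a₂ :* a₂) :* (a₁ :* d₁ :+ b₁ :* c₁))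
  (λ _ → refl)
  where open F₂-RingSolver n

module _ (z : Fin n) where

  -- For F = x_z F₁ + F₂ and G = x_z G₁ + G₂, the coefficients of x_z², x_z, 1 in F G.
  topCoeff midCoeff lowCoeff : Poly n → Poly n → Poly n
  topCoeff F G = deriv F z ⊛ deriv G z
  midCoeff F G = deriv F z ⊛ subst0 G z ⊕ subst0 F z ⊛ deriv G z
  lowCoeff F G = subst0 F z ⊛ subst0 G z

  ⊛-asQuadratic : (F G : Poly n) → Multilinear F → Multilinear G →
    F ⊛ G ≈ quadratic z (topCoeff F G) (midCoeff F G) (lowCoeff F G)
  ⊛-asQuadratic F G multilinearF multilinearG m =
    trans (⊛-cong (multilinear-split z F multilinearF) (multilinear-split z G multilinearG) m)
          (product-expansion (X z) (deriv F z) (subst0 F z) (deriv G z) (subst0 G z) m)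

  zfree-coefficients : (F G : Poly n) →
    ZFree z (topCoeff F G) × ZFree z (midCoeff F G) × ZFree z (lowCoeff F G)
  zfree-coefficients F G =
      zfree-⊛ z F₁ G₁ (zfree-deriv z F) (zfree-deriv z G)
    , zfree-⊕ z {F₁ ⊛ G₂} {F₂ ⊛ G₁} (zfree-⊛ z F₁ G₂ (zfree-deriv z F) (zfree-subst0 z G))
                                    (zfree-⊛ z F₂ G₁ (zfree-subst0 z F) (zfree-deriv z G))
    , zfree-⊛ z F₂ G₂ (zfree-subst0 z F) (zfree-subst0 z G)
    where
    F₁ F₂ G₁ G₂ : Poly n
    F₁ = deriv F z
    F₂ = subst0 F z
    G₁ = deriv G z
    G₂ = subst0 G z

  product-equation⇔coefficients : (A B C D : Poly n) →
    Multilinear A → Multilinear B → Multilinear C → Multilinear D →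
    (A ⊛ D ≈ B ⊛ C) ⇔
      (topCoeff A D ≈ topCoeff B C × midCoeff A D ≈ midCoeff B C × lowCoeff A D ≈ lowCoeff B C)
  product-equation⇔coefficients A B C D mA mB mC mD = mk⇔ compare combine
    where
    CoefficientsAgree : Set
    CoefficientsAgree = topCoeff A D ≈ topCoeff B C × midCoeff A D ≈ midCoeff B C × lowCoeff A D ≈ lowCoeff B C

    compare : A ⊛ D ≈ B ⊛ C → CoefficientsAgree
    compare AD≈BC =
      let freeT₁ , freeM₁ , freeL₁ = zfree-coefficients A D
          freeT₂ , freeM₂ , freeL₂ = zfree-coefficients B C
      in quadratic-injective z freeT₁ freeM₁ freeL₁ freeT₂ freeM₂ freeL₂
           (λ m → trans (sym (⊛-asQuadratic A D mA mD m)) (trans (AD≈BC m) (⊛-asQuadratic B C mB mC m)))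

    combine : CoefficientsAgree → A ⊛ D ≈ B ⊛ C
    combine (top , mid , low) m =
      trans (⊛-asQuadratic A D mA mD m)
            (trans (quadratic-cong z top mid low m) (sym (⊛-asQuadratic B C mB mC m)))

≈⇔⊕≈0 : {P Q : Poly n} → (P ≈ Q) ⇔ (P ⊕ Q ≈ 0P)
≈⇔⊕≈0 {P = P} {Q} = mk⇔ (λ P≈Q m → trans (cong (_xor Q m) (P≈Q m)) (xor-same (Q m)))
                          (λ P⊕Q≈0 m → xor≡false⇒≡ (P m) (Q m) (P⊕Q≈0 m))
  where
  xor≡false⇒≡ : ∀ a b → a xor b ≡ false → a ≡ b
  xor≡false⇒≡ false false _ = refl
  xor≡false⇒≡ true  true  _ = refl

cancel-nonzero-factor : (b : ℕ) (a M U V : Poly n) →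
  Bounded b a → Bounded b M → Bounded b U → Bounded b V →
  ¬ a ≈ 0P → a ⊛ M ≈ U ⊛ V → (M ≈ 0P) ⇔ (U ≈ 0P ⊎ V ≈ 0P)
cancel-nonzero-factor b a M U V boundA boundM boundU boundV a≉0 aM≈UV = mk⇔ forward backward
  where
  forward : M ≈ 0P → U ≈ 0P ⊎ V ≈ 0P
  forward M≈0 = zero-product b U V boundU boundV (λ m → trans (sym (aM≈UV m)) (⊛-annihilʳ a M≈0 m))
  backward : U ≈ 0P ⊎ V ≈ 0P → M ≈ 0P
  backward U≈0⊎V≈0 with zero-product b a M boundA boundM (λ m → trans (aM≈UV m) (UV≈0 U≈0⊎V≈0 m))
    where
    UV≈0 : U ≈ 0P ⊎ V ≈ 0P → U ⊛ V ≈ 0P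
    UV≈0 (inj₁ U≈0) = ⊛-annihilˡ V U≈0
    UV≈0 (inj₂ V≈0) = ⊛-annihilʳ U V≈0
  ... | inj₁ a≈0 = contradiction a≈0 a≉0
  ... | inj₂ M≈0 = M≈0

middle-product : (z : Fin n) (A B C D : Poly n) →
  topCoeff z A D ≈ topCoeff z B C → lowCoeff z A D ≈ lowCoeff z B C →
  (deriv A z ⊛ subst0 A z) ⊛ (midCoeff z A D ⊕ midCoeff z B C) ≈
    (deriv A z ⊛ subst0 B z ⊕ subst0 A z ⊛ deriv B z) ⊛ (deriv A z ⊛ subst0 C z ⊕ subst0 A z ⊛ deriv C z)
middle-product z A B C D top low m = begin
  ((A₁ ⊛ A₂) ⊛ (midCoeff z A D ⊕ midCoeff z B C)) m
    ≡⟨ middle-identity A₁ A₂ B₁ B₂ C₁ C₂ D₁ D₂ m ⟩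
  ((U ⊛ V) m xor ((A₁ ⊛ A₁) ⊛ (A₂ ⊛ D₂ ⊕ B₂ ⊛ C₂)) m) xor ((A₂ ⊛ A₂) ⊛ (A₁ ⊛ D₁ ⊕ B₁ ⊛ C₁)) m
    ≡⟨ cong₂ (λ u v → ((U ⊛ V) m xor u) xor v)
             (⊛-annihilʳ (A₁ ⊛ A₁) (Equivalence.to ≈⇔⊕≈0 low) m)
             (⊛-annihilʳ (A₂ ⊛ A₂) (Equivalence.to ≈⇔⊕≈0 top) m) ⟩
  ((U ⊛ V) m xor false) xor false
    ≡⟨ trans (xor-identityʳ _) (xor-identityʳ _) ⟩
  (U ⊛ V) m ∎
  where
  open ≡-Reasoning
  A₁ A₂ B₁ B₂ C₁ C₂ D₁ D₂ U V : Poly _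
  A₁ = deriv A z
  A₂ = subst0 A z
  B₁ = deriv B z
  B₂ = subst0 B z
  C₁ = deriv C z
  C₂ = subst0 C z
  D₁ = deriv D z
  D₂ = subst0 D z
  U = A₁ ⊛ B₂ ⊕ A₂ ⊛ B₁
  V = A₁ ⊛ C₂ ⊕ A₂ ⊛ C₁

-- Given (i) and (ii), the middle coefficient equation is equivalent to (iii):
-- cancel A₁A₂ ≠ 0 in A₁A₂ M = U V, all polynomials having exponents ≤ 2.
middle-condition : (z : Fin n) (A B C D : Poly n) →
  Multilinear A → Multilinear B → Multilinear C → Multilinear D →
  ¬ deriv A z ≈ 0P → ¬ subst0 A z ≈ 0P →
  topCoeff z A D ≈ topCoeff z B C → lowCoeff z A D ≈ lowCoeff z B C →
  (midCoeff z A D ≈ midCoeff z B C) ⇔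
    ((deriv A z ⊛ subst0 B z ≈ subst0 A z ⊛ deriv B z) ⊎ (deriv A z ⊛ subst0 C z ≈ subst0 A z ⊛ deriv C z))
middle-condition z A B C D mA mB mC mD A₁≉0 A₂≉0 top low = begin
  (midCoeff z A D ≈ midCoeff z B C)             ≈⟨ ≈⇔⊕≈0 ⟩
  (M ≈ 0P)                                      ≈⟨ cancel-nonzero-factor 2 (A₁ ⊛ A₂) M U V
                                                     (bounded-⊛ A₁ A₂ bA₁ bA₂)
                                                     (bounded-⊕ _ _ (bounded-mid A D mA mD) (bounded-mid B C mB mC))
                                                     (bounded-pairing bA₁ bB₂ bA₂ bB₁) (bounded-pairing bA₁ bC₂ bA₂ bC₁)
                                                     (no-zero-divisors 1 A₁ A₂ bA₁ bA₂ A₁≉0 A₂≉0)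
                                                     (middle-product z A B C D top low) ⟩
  (U ≈ 0P ⊎ V ≈ 0P)                             ≈⟨ ≈⇔⊕≈0 ⊎-⇔ ≈⇔⊕≈0 ⟨
  (A₁ ⊛ B₂ ≈ A₂ ⊛ B₁ ⊎ A₁ ⊛ C₂ ≈ A₂ ⊛ C₁)        ∎
  where
  open import Relation.Binary.Reasoning.Setoid (⇔-setoid 0ℓ)
  A₁ A₂ B₁ B₂ C₁ C₂ U V M : Poly _
  A₁ = deriv A z
  A₂ = subst0 A z
  B₁ = deriv B z
  B₂ = subst0 B z
  C₁ = deriv C z
  C₂ = subst0 C z
  U = A₁ ⊛ B₂ ⊕ A₂ ⊛ B₁
  V = A₁ ⊛ C₂ ⊕ A₂ ⊛ C₁
  M = midCoeff z A D ⊕ midCoeff z B C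

  bA₁ : Bounded 1 A₁
  bA₁ = bounded-deriv z A mA
  bA₂ : Bounded 1 A₂
  bA₂ = bounded-subst0 z A mA
  bB₂ : Bounded 1 B₂
  bB₂ = bounded-subst0 z B mB
  bB₁ : Bounded 1 B₁
  bB₁ = bounded-deriv z B mB
  bC₂ : Bounded 1 C₂
  bC₂ = bounded-subst0 z C mC
  bC₁ : Bounded 1 C₁
  bC₁ = bounded-deriv z C mC

  bounded-pairing : {P Q R S : Poly _} → Bounded 1 P → Bounded 1 Q → Bounded 1 R → Bounded 1 S →
    Bounded 2 (P ⊛ Q ⊕ R ⊛ S)
  bounded-pairing {P} {Q} {R} {S} bP bQ bR bS =
    bounded-⊕ (P ⊛ Q) (R ⊛ S) (bounded-⊛ P Q bP bQ) (bounded-⊛ R S bR bS)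

  bounded-mid : (F G : Poly _) → Multilinear F → Multilinear G → Bounded 2 (midCoeff z F G)
  bounded-mid F G mF mG = bounded-pairing (bounded-deriv z F mF) (bounded-subst0 z G mG)
                                          (bounded-subst0 z F mF) (bounded-deriv z G mG)

mainTheorem1 : ∀ (n : ℕ) (A B C D : Poly n) (z : Fin n) →
    Multilinear A → Multilinear B → Multilinear C → Multilinear D →
    ¬ (deriv A z ≈ 0P) → ¬ (subst0 A z ≈ 0P) →
    ((A ⊛ D ≈ B ⊛ C) ⇔
      ((deriv A z ⊛ deriv D z ≈ deriv B z ⊛ deriv C z)
       × (subst0 A z ⊛ subst0 D z ≈ subst0 B z ⊛ subst0 C z)
       × ((deriv A z ⊛ subst0 B z ≈ subst0 A z ⊛ deriv B z)
          ⊎ (deriv A z ⊛ subst0 C z ≈ subst0 A z ⊛ deriv C z))))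
mainTheorem1 n A B C D z mA mB mC mD A₁≉0 A₂≉0 = mk⇔ necessary sufficient
  where
  Condition-i Condition-ii Condition-iii : Set
  Condition-i   = topCoeff z A D ≈ topCoeff z B C
  Condition-ii  = lowCoeff z A D ≈ lowCoeff z B C
  Condition-iii = (deriv A z ⊛ subst0 B z ≈ subst0 A z ⊛ deriv B z)
                  ⊎ (deriv A z ⊛ subst0 C z ≈ subst0 A z ⊛ deriv C z)

  coefficients : (A ⊛ D ≈ B ⊛ C) ⇔ (Condition-i × midCoeff z A D ≈ midCoeff z B C × Condition-ii)
  coefficients = product-equation⇔coefficients z A B C D mA mB mC mD

  middle : Condition-i → Condition-ii → (midCoeff z A D ≈ midCoeff z B C) ⇔ Condition-iii
  middle = middle-condition z A B C D mA mB mC mD A₁≉0 A₂≉0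

  necessary : A ⊛ D ≈ B ⊛ C → Condition-i × Condition-ii × Condition-iii
  necessary AD≈BC =
    let top , mid , low = Equivalence.to coefficients AD≈BC
    in top , low , Equivalence.to (middle top low) mid

  sufficient : Condition-i × Condition-ii × Condition-iii → A ⊛ D ≈ B ⊛ C
  sufficient (top , low , iii) = Equivalence.from coefficients (top , Equivalence.from (middle top low) iii , low)
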